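{- Let $G$ be a finite abelian group and let $d',d$ be positive integers with $d' \mid d \mid \exp(G)$. Let $S$ be a sequence in $G$, let $T$ be the subsequence of $S$ consisting of all terms whose order divides $d/d'$, and let $U$ be the subsequence of $S$ consisting of all terms whose order divides $d$. If $$|T|+\left\lfloor\frac{|U|-|T|}{\mathsf{D}_{(d',d)}(G)}\right\rfloor \geq \mathsf{D}_{(d/d',\,d/d')}(G),$$ then $S$ is not zero-sumfree.
   Context: A sequence in $G$ is a finite unordered list of elements of $G$ with repetition allowed; $|S|$ is its length counted with multiplicity. A sequence is zero-sumfree if no nonempty subsequence has sum $0$. For a divisor $m$ of $\exp(G)$, $G_m=\{x\in G : mx=0\}$. For positive integers $d' \mid d \mid \exp(G)$, $\mathsf{D}_{(d',d)}(G)$ denotes the smallest positive integer $t$ such that every sequence of elements of $G_d$ of length at least $t$ contains a nonempty subsequence whose sum lies in $G_{d/d'}$. -}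

module Defs where

open import Level using (_⊔_)
open import Algebra.Bundles using (AbelianGroup)
open import Data.Nat using (ℕ; zero; suc; _≤_; _<_; NonZero)
open import Data.Nat.DivMod using (_/_)
open import Data.List using (List; []; length; foldr; filter)
open import Data.List.Relation.Unary.All using (All)
open import Data.List.Relation.Unary.Any using (Any)
open import Data.List.Relation.Binary.Sublist.Propositional using (_⊆_)
open import Data.Product using (Σ; _×_; ∃; ∃-syntax)
open import Relation.Nullary using (¬_)
open import Relation.Binary using (Decidable)
open import Relation.Binary.PropositionalEquality using (_≢_)

module WithGroup {c ℓ} (G : AbelianGroup c ℓ) where
  open AbelianGroup G

  mul : ℕ → Carrier → Carrier
  mul zero    x = ε
  mul (suc n) x = x ∙ mul n x

  -- "the order of x divides m"  ⇔  m·x = 0   (i.e. x ∈ G_m)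
  OrdDiv : ℕ → Carrier → Set ℓ
  OrdDiv m x = mul m x ≈ ε

  Finite : Set (c ⊔ ℓ)
  Finite = Σ (List Carrier) (λ xs → ∀ x → Any (x ≈_) xs)

  IsExponent : ℕ → Set (c ⊔ ℓ)
  IsExponent e = (0 < e) × (∀ x → OrdDiv e x)
               × (∀ n → 0 < n → (∀ x → OrdDiv n x) → e ≤ n)

  -- sum of a sequence (sequences are lists; order irrelevant by commutativity)
  σ : List Carrier → Carrier
  σ = foldr _∙_ ε

  ZeroSumFree : List Carrier → Set (c ⊔ ℓ)
  ZeroSumFree S = ∀ (W : List Carrier) → W ⊆ S → W ≢ [] → ¬ (σ W ≈ ε)

  DProp : (d' d : ℕ) .{{_ : NonZero d'}} → ℕ → Set (c ⊔ ℓ)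
  DProp d' d t = ∀ (S : List Carrier) → All (OrdDiv d) S → t ≤ length S →
                 ∃[ W ] (W ⊆ S × W ≢ [] × OrdDiv (d / d') (σ W))

  IsD : (d' d : ℕ) .{{_ : NonZero d'}} → ℕ → Set (c ⊔ ℓ)
  IsD d' d t = (0 < t) × DProp d' d t × (∀ t' → 0 < t' → DProp d' d t' → t ≤ t')

  module _ (_≟_ : Decidable _≈_) where
    sub : ℕ → List Carrier → List Carrier
    sub m = filter (λ x → mul m x ≟ ε)

-- Every term x of T gives the one-term block [x], whose sum lies in G_{d/d'}.
-- The terms of U outside T have order dividing d, so D_{(d',d)}(G) of them always
-- contain a nonempty block with sum in G_{d/d'}; removing such blocks greedily yields
-- ⌊(|U| - |T|) / D_{(d',d)}(G)⌋ more disjoint blocks. The block sums then form a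
-- sequence over G_{d/d'} of length at least D_{(d/d',d/d')}(G), so some nonempty
-- subfamily of blocks has total sum in G_1 = {0}; their union is a nonempty
-- zero-sum subsequence of S.
module Submission where

open import Defs
open import Algebra.Bundles using (AbelianGroup; CommutativeMonoid)
open import Data.Nat using (ℕ; zero; suc; _+_; _*_; _∸_; _≤_; _≥_; _<_; z≤n; s≤s; NonZero)
open import Data.Nat.Properties
  using (≤-reflexive; ≤-trans; m≤n⇒m≤1+n; m≤m+n; +-suc; +-monoˡ-≤; +-mono-≤; +-cancelˡ-≤;
         m⊓n≤m; m≤n⇒m⊓n≡m; m≤n+o⇒m∸n≤o; module ≤-Reasoning)
open import Data.Nat.DivMod using (_/_; m/n*n≤m; n/n≡1)
open import Data.Nat.Divisibility using (_∣_)
open import Data.List using (List; []; _∷_; [_]; _++_; length; map; filter; take; foldr)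
open import Data.List.Properties using (length-++; length-map; length-take)
open import Data.List.Relation.Unary.All as All using (All; []; _∷_)
open import Data.List.Relation.Unary.All.Properties using (++⁺; map⁺; all-filter)
open import Data.List.Relation.Binary.Sublist.Propositional
  using (_⊆_; []; _∷_; _∷ʳ_; minimum; ⊆-trans)
open import Data.List.Relation.Binary.Sublist.Propositional.Properties using (All-resp-⊆; take-⊆; filter-⊆)
open import Data.List.Relation.Binary.Sublist.Heterogeneous.Properties using (length-mono-≤)
open import Data.List.Relation.Ternary.Interleaving.Propositional
  using (Interleaving; []; consˡ; consʳ; right)
open import Data.List.Relation.Ternary.Interleaving.Properties using (interleave-length)
open import Data.List.Relation.Binary.Pointwise as Pointwise using ()
open import Data.Product using (_×_; _,_; proj₁; proj₂; ∃-syntax; ∃₂)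
open import Function using (_∘_)
open import Level using (Level; _⊔_)
open import Relation.Nullary using (¬_; yes; no; ¬?)
open import Relation.Binary using (Decidable)
open import Relation.Binary.PropositionalEquality using (_≡_; _≢_; refl; sym; trans; cong; cong₂; subst)
open import Relation.Unary using (Pred) renaming (Decidable to Decidable₁)

private
  variable
    a p q : Level

module _ {A : Set a} where

  ≢[]⇒0<length : ∀ {xs : List A} → xs ≢ [] → 0 < length xs
  ≢[]⇒0<length {[]}    xs≢[] with () ← xs≢[] refl
  ≢[]⇒0<length {_ ∷ _} _     = s≤s z≤n

  0<length⇒≢[] : ∀ {xs : List A} → 0 < length xs → xs ≢ []
  0<length⇒≢[] {_ ∷ _} _ ()

  ⊆⇒Interleaving : ∀ {W V : List A} → W ⊆ V → ∃[ R ] Interleaving W R V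
  ⊆⇒Interleaving []       = [] , []
  ⊆⇒Interleaving (y ∷ʳ τ) = let R , ι = ⊆⇒Interleaving τ in y ∷ R , consʳ ι
  ⊆⇒Interleaving (refl ∷ τ) = let R , ι = ⊆⇒Interleaving τ in R , consˡ ι

  Interleaving⇒⊆ʳ : ∀ {W R V : List A} → Interleaving W R V → R ⊆ V
  Interleaving⇒⊆ʳ []        = []
  Interleaving⇒⊆ʳ (consˡ ι) = _ ∷ʳ Interleaving⇒⊆ʳ ι
  Interleaving⇒⊆ʳ (consʳ ι) = refl ∷ Interleaving⇒⊆ʳ ι

  extendʳ : ∀ {W R V S : List A} → Interleaving W R V → V ⊆ S →
            ∃[ R′ ] (Interleaving W R′ S × R ⊆ R′)
  extendʳ []        []         = [] , [] , []
  extendʳ ι         (y ∷ʳ τ)   = let R′ , ι′ , ρ = extendʳ ι τ in y ∷ R′ , consʳ ι′ , y ∷ʳ ρ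
  extendʳ (consˡ ι) (refl ∷ τ) = let R′ , ι′ , ρ = extendʳ ι τ in R′ , consˡ ι′ , ρ
  extendʳ (consʳ ι) (refl ∷ τ) = let R′ , ι′ , ρ = extendʳ ι τ in _ ∷ R′ , consʳ ι′ , refl ∷ ρ

  shrinkʳ : ∀ {W R S R′ : List A} → Interleaving W R S → R′ ⊆ R →
            ∃[ V ] (Interleaving W R′ V × V ⊆ S)
  shrinkʳ []        []         = [] , [] , []
  shrinkʳ (consˡ ι) ρ          = let V , ι′ , τ = shrinkʳ ι ρ in _ ∷ V , consˡ ι′ , refl ∷ τ
  shrinkʳ (consʳ ι) (y ∷ʳ ρ)   = let V , ι′ , τ = shrinkʳ ι ρ in V , ι′ , y ∷ʳ τ
  shrinkʳ (consʳ ι) (refl ∷ ρ) = let V , ι′ , τ = shrinkʳ ι ρ in _ ∷ V , consʳ ι′ , refl ∷ τ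

  -- Blocks Ws S L: S is the disjoint union of the blocks Ws and the leftover L.
  data Blocks : List (List A) → List A → List A → Set a where
    []  : ∀ {S} → Blocks [] S S
    _∷_ : ∀ {W R S L Ws} → Interleaving W R S → Blocks Ws R L → Blocks (W ∷ Ws) S L

  Blocks-++ : ∀ {Ws₁ Ws₂ S L L′} → Blocks Ws₁ S L → Blocks Ws₂ L L′ → Blocks (Ws₁ ++ Ws₂) S L′
  Blocks-++ []      β = β
  Blocks-++ (ι ∷ β) γ = ι ∷ Blocks-++ β γ

  Blocks-skip : ∀ {Ws S L} x → Blocks Ws S L → Blocks Ws (x ∷ S) (x ∷ L)
  Blocks-skip x []      = []
  Blocks-skip x (ι ∷ β) = consʳ ι ∷ Blocks-skip x β

  Blocks-⊆ : ∀ {Ws V L S} → Blocks Ws V L → V ⊆ S → ∃[ L′ ] Blocks Ws S L′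
  Blocks-⊆ []      τ = _ , []
  Blocks-⊆ (ι ∷ β) τ = let _ , ι′ , ρ = extendʳ ι τ ; L′ , β′ = Blocks-⊆ β ρ in L′ , ι′ ∷ β′

  singleton-Blocks : {P : Pred A p} (P? : Decidable₁ P) →
                     ∀ S → Blocks (map [_] (filter P? S)) S (filter (¬? ∘ P?) S)
  singleton-Blocks P? []      = []
  singleton-Blocks P? (x ∷ S) with P? x
  ... | yes _ = consˡ (right (Pointwise.refl refl)) ∷ singleton-Blocks P? S
  ... | no  _ = Blocks-skip x (singleton-Blocks P? S)

  length-filter-≤-+ : {P : Pred A p} {Q : Pred A q} (P? : Decidable₁ P) (Q? : Decidable₁ Q) →
    ∀ S → length (filter Q? S) ≤ length (filter P? S) + length (filter Q? (filter (¬? ∘ P?) S))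
  length-filter-≤-+ P? Q? []      = z≤n
  length-filter-≤-+ P? Q? (x ∷ S) with P? x
  ... | yes _ with Q? x
  ...   | yes _ = s≤s (length-filter-≤-+ P? Q? S)
  ...   | no  _ = m≤n⇒m≤1+n (length-filter-≤-+ P? Q? S)
  length-filter-≤-+ P? Q? (x ∷ S) | no _ with Q? x
  ...   | yes _ = subst (suc (length (filter Q? S)) ≤_) (sym (+-suc (length (filter P? S)) _))
                    (s≤s (length-filter-≤-+ P? Q? S))
  ...   | no  _ = length-filter-≤-+ P? Q? S

  module _ {P : Pred A p} {Q : Pred (List A) q} (D : ℕ)
           (extract : ∀ X → All P X → D ≤ length X → ∃[ W ] (W ⊆ X × W ≢ [] × Q W)) where

    greedy-Blocks : ∀ n V → All P V → n * D ≤ length V →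
                    ∃₂ λ Ws L → Blocks Ws V L × length Ws ≡ n × All (λ W → W ≢ [] × Q W) Ws
    greedy-Blocks zero    V _  _     = [] , V , [] , refl , []
    greedy-Blocks (suc n) V PV n*D≤V =
      let D≤V = ≤-trans (m≤m+n D (n * D)) n*D≤V
          W , W⊆take , W≢[] , QW = extract (take D V) (All-resp-⊆ (take-⊆ D V) PV)
                                           (≤-reflexive (sym (length-take≡D D≤V)))
          R , ι = ⊆⇒Interleaving (⊆-trans W⊆take (take-⊆ D V))
          Ws , L , β , length≡n , good =
            greedy-Blocks n R (All-resp-⊆ (Interleaving⇒⊆ʳ ι) PV) (+-cancelˡ-≤ D _ _ (D+n*D≤D+R W⊆take ι))
      in W ∷ Ws , L , ι ∷ β , cong suc length≡n , (W≢[] , QW) ∷ good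
      where
      length-take≡D : D ≤ length V → length (take D V) ≡ D
      length-take≡D D≤V = subst (length (take D V) ≡_) (m≤n⇒m⊓n≡m D≤V) (length-take D V)

      D+n*D≤D+R : ∀ {W R} → W ⊆ take D V → Interleaving W R V → D + n * D ≤ D + length R
      D+n*D≤D+R {W} {R} W⊆take ι = begin
        D + n * D              ≤⟨ n*D≤V ⟩
        length V               ≡⟨ interleave-length ι ⟩
        length W + length R    ≤⟨ +-monoˡ-≤ (length R) (≤-trans (length-mono-≤ W⊆take)
                                    (subst (_≤ D) (sym (length-take D V)) (m⊓n≤m D (length V)))) ⟩
        D + length R           ∎
        where open ≤-Reasoning

module BlockSums {c ℓ} (M : CommutativeMonoid c ℓ) where
  open CommutativeMonoid M renaming (refl to ≈-refl; sym to ≈-sym; trans to ≈-trans)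
  open import Relation.Binary.Reasoning.Setoid setoid

  σ : List Carrier → Carrier
  σ = foldr _∙_ ε

  σ-Interleaving : ∀ {W R S} → Interleaving W R S → σ S ≈ σ W ∙ σ R
  σ-Interleaving [] = ≈-sym (identityˡ ε)
  σ-Interleaving {x ∷ W} {R} {x ∷ S} (consˡ ι) = begin
    x ∙ σ S           ≈⟨ ∙-congˡ (σ-Interleaving ι) ⟩
    x ∙ (σ W ∙ σ R)   ≈⟨ assoc x (σ W) (σ R) ⟨
    x ∙ σ W ∙ σ R     ∎
  σ-Interleaving {W} {x ∷ R} {x ∷ S} (consʳ ι) = begin
    x ∙ σ S           ≈⟨ ∙-congˡ (σ-Interleaving ι) ⟩
    x ∙ (σ W ∙ σ R)   ≈⟨ assoc x (σ W) (σ R) ⟨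
    x ∙ σ W ∙ σ R     ≈⟨ ∙-congʳ (comm x (σ W)) ⟩
    σ W ∙ x ∙ σ R     ≈⟨ assoc (σ W) x (σ R) ⟩
    σ W ∙ (x ∙ σ R)   ∎

  -- Choosing some of the block sums amounts to choosing the union of those blocks.
  Blocks-subsum : ∀ {Ws S L Cs} → Blocks Ws S L → All (_≢ []) Ws → Cs ⊆ map σ Ws →
                  ∃[ V ] (V ⊆ S × σ V ≈ σ Cs × length Cs ≤ length V)
  Blocks-subsum []      []         [] = [] , minimum _ , ≈-refl , z≤n
  Blocks-subsum (ι ∷ β) (_ ∷ ne) (_ ∷ʳ τ) =
    let V , V⊆ , σV , len = Blocks-subsum β ne τ in V , ⊆-trans V⊆ (Interleaving⇒⊆ʳ ι) , σV , len
  Blocks-subsum (ι ∷ β) (W≢[] ∷ ne) (refl ∷ τ) =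
    let V′ , V′⊆ , σV′ , len = Blocks-subsum β ne τ
        V , ι′ , V⊆ = shrinkʳ ι V′⊆
    in V , V⊆ , ≈-trans (σ-Interleaving ι′) (∙-congˡ σV′) ,
       subst (_ ≤_) (sym (interleave-length ι′)) (+-mono-≤ (≢[]⇒0<length W≢[]) len)

module _ {c ℓ} (G : AbelianGroup c ℓ) where
  open AbelianGroup G renaming (refl to ≈-refl; sym to ≈-sym; trans to ≈-trans)
  open WithGroup G
  open BlockSums commutativeMonoid using (Blocks-subsum)

  mul-cong : ∀ n {x y} → x ≈ y → mul n x ≈ mul n y
  mul-cong zero    x≈y = ≈-refl
  mul-cong (suc n) x≈y = ∙-cong x≈y (mul-cong n x≈y)

  OrdDiv-1 : ∀ {x} → OrdDiv 1 x → x ≈ ε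
  OrdDiv-1 {x} x∙ε≈ε = ≈-trans (≈-sym (identityʳ x)) x∙ε≈ε

  OrdDiv-singleton : ∀ k {x} → OrdDiv k x → OrdDiv k (σ [ x ])
  OrdDiv-singleton k {x} kx≈ε = ≈-trans (mul-cong k (identityʳ x)) kx≈ε

  Block : ℕ → List Carrier → Set (c ⊔ ℓ)
  Block k W = W ≢ [] × OrdDiv k (σ W)

  module _ (_≟_ : Decidable _≈_) (k d D : ℕ) .{{_ : NonZero D}}
           (extract : ∀ X → All (OrdDiv d) X → D ≤ length X →
                      ∃[ W ] (W ⊆ X × W ≢ [] × OrdDiv k (σ W))) where

    many-Blocks : ∀ S → ∃₂ λ Ws L → Blocks Ws S L × All (Block k) Ws ×
      length (sub _≟_ k S) + (length (sub _≟_ d S) ∸ length (sub _≟_ k S)) / D ≤ length Ws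
    many-Blocks S =
      let Ws₂ , _ , β , length-Ws₂ , good₂ = greedy-Blocks D extract m (sub _≟_ d R) (all-filter _ R) m*D≤U∖T
          _ , β′ = Blocks-⊆ β (filter-⊆ _ R)
      in map [_] T ++ Ws₂ , _ , Blocks-++ (singleton-Blocks k? S) β′ , ++⁺ singletons-Block good₂ ,
         ≤-reflexive (trans (cong₂ _+_ (sym (length-map [_] T)) (sym length-Ws₂)) (sym (length-++ (map [_] T))))
      where
      k? : Decidable₁ (OrdDiv k)
      k? x = mul k x ≟ ε
      T = sub _≟_ k S
      U = sub _≟_ d S
      R = filter (¬? ∘ k?) S
      m = (length U ∸ length T) / D

      singletons-Block : All (Block k) (map [_] T)
      singletons-Block = map⁺ (All.map (λ kx → (λ ()) , OrdDiv-singleton k kx) (all-filter k? S))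

      m*D≤U∖T : m * D ≤ length (sub _≟_ d R)
      m*D≤U∖T = ≤-trans (m/n*n≤m (length U ∸ length T) D)
                        (m≤n+o⇒m∸n≤o (length U) (length T) (length-filter-≤-+ k? (λ x → mul d x ≟ ε) S))

  Blocks-zero-subsum⇒¬ZeroSumFree : ∀ {Ws S L Cs} → Blocks Ws S L → All (_≢ []) Ws →
    Cs ⊆ map σ Ws → Cs ≢ [] → σ Cs ≈ ε → ¬ ZeroSumFree S
  Blocks-zero-subsum⇒¬ZeroSumFree β nonempty Cs⊆ Cs≢[] σCs≈ε zsf =
    let V , V⊆S , σV≈σCs , Cs≤V = Blocks-subsum β nonempty Cs⊆
    in zsf V V⊆S (0<length⇒≢[] (≤-trans (≢[]⇒0<length Cs≢[]) Cs≤V)) (≈-trans σV≈σCs σCs≈ε)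

lemma3p1 : ∀ {c ℓ} (G : AbelianGroup c ℓ) →
    (_≟_ : Decidable (AbelianGroup._≈_ G)) → WithGroup.Finite G →
    (e : ℕ) → WithGroup.IsExponent G e →
    (d' d : ℕ) .{{_ : NonZero d'}} .{{_ : NonZero d}} .{{_ : NonZero (d / d')}} → d' ∣ d → d ∣ e →
    (D₁ D₂ : ℕ) .{{_ : NonZero D₁}} →
    WithGroup.IsD G d' d D₁ →
    WithGroup.IsD G (d / d') (d / d') D₂ →
    (S : List (AbelianGroup.Carrier G)) →
    length (WithGroup.sub G _≟_ (d / d') S)
      + (length (WithGroup.sub G _≟_ d S) ∸ length (WithGroup.sub G _≟_ (d / d') S)) / D₁
      ≥ D₂ →
    ¬ WithGroup.ZeroSumFree G S
lemma3p1 G _≟_ _ _ _ d' d _ _ D₁ D₂ (_ , extract , _) (_ , zero-subsum , _) S bound =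
  let Ws , _ , β , blocks , many = many-Blocks G _≟_ (d / d') d D₁ extract S
      Cs , Cs⊆ , Cs≢[] , σCs∈G₁ = zero-subsum (map σ Ws) (map⁺ (All.map proj₂ blocks))
                                    (≤-trans bound (subst (_ ≤_) (sym (length-map σ Ws)) many))
  in Blocks-zero-subsum⇒¬ZeroSumFree G β (All.map proj₁ blocks) Cs⊆ Cs≢[]
       (OrdDiv-1 G (subst (λ n → mul n (σ Cs) ≈ ε) (n/n≡1 (d / d')) σCs∈G₁))
  where open AbelianGroup G using (_≈_; ε)
        open WithGroup G using (σ; mul)
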